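{- For every integer $n\ge2$, $\zeta(n,(n-1)^2)<n$; that is, there exists an $(n,(n-1)^2)$-fractionally balanced bipartite graph $G$ with $\eta(\mathcal{M}(G))<n$.
   Context: A bipartite graph $G$ with sides of sizes $a,b$ is $(a,b)$-fractionally balanced if there is a nonzero $f:E(G)\to\mathbb{R}_{\ge0}$ such that $\deg_f(v)=\sum_{e\ni v}f(e)$ is constant on each side. $\zeta(a,b)$ is the minimum of $\eta(\mathcal{M}(G))$ over all $(a,b)$-fractionally balanced bipartite graphs $G$. $\mathcal{M}(G)$ is the matching complex: the simplicial complex on vertex set $E(G)$ whose faces are the matchings of $G$. For a simplicial complex $\mathcal{C}$, $\eta(\mathcal{C})$ is the largest $k$ such that the reduced homology groups $\tilde H_j(\mathcal{C};\mathbb{Q})$ vanish for all $-1\le j\le k$, plus $2$. -}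

module Defs where

open import Data.Nat using (ℕ; zero; suc; _<_) renaming (_*_ to _*ℕ_)
open import Data.Fin using (Fin; remQuot; _<?_)
import Data.Fin as F
open import Data.Fin.Properties using () renaming (_≟_ to _≟F_)
open import Data.Bool using (Bool; true; false; if_then_else_)
open import Data.List using (List; []; _∷_; length; map; foldr; allFin)
open import Data.List.Relation.Unary.All using (All)
open import Data.List.Relation.Unary.AllPairs using (AllPairs)
open import Data.List.Relation.Unary.Linked using (Linked)
import Data.List.Membership.DecPropositional as DecMem
open import Data.Product using (_×_; Σ; ∃; _,_; proj₁; proj₂)
open import Data.Rational using (ℚ; 0ℚ; 1ℚ; _+_; _*_; -_) renaming (_≤_ to _≤ℚ_)
open import Relation.Binary.PropositionalEquality using (_≡_; _≢_)
open import Relation.Nullary using (¬_; yes; no)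

sumℚ : List ℚ → ℚ
sumℚ = foldr _+_ 0ℚ

ΣFin : (n : ℕ) → (Fin n → ℚ) → ℚ
ΣFin n g = sumℚ (map g (allFin n))

-- A simplex is represented by the strictly increasing
-- list of its vertices; a complex is given by a predicate `Face` on such
-- lists (the empty face included).  A simplex of dimension j has
-- length j + 1; we index everything by the length ℓ = j + 1, so
-- ℓ = 0 is the augmentation degree j = -1.

Simplex : ℕ → Set
Simplex m = List (Fin m)

StrictlyIncreasing : {m : ℕ} → Simplex m → Set
StrictlyIncreasing = Linked F._<_

sgn : ℕ → ℚ
sgn zero    = 1ℚ
sgn (suc p) = - sgn p

-- insert v into a strictly increasing list (v assumed not in it);
-- returns the position of v in the result and the resulting list
insertAt : {m : ℕ} → Fin m → Simplex m → ℕ × Simplex m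
insertAt v [] = 0 , v ∷ []
insertAt v (x ∷ xs) with v <? x
... | yes _ = 0 , v ∷ x ∷ xs
... | no  _ = suc (proj₁ (insertAt v xs)) , x ∷ proj₂ (insertAt v xs)

Chain : {m : ℕ} → (Face : Simplex m → Set) → ℕ → (Simplex m → ℚ) → Set
Chain {m} Face ℓ c = ∀ σ → c σ ≢ 0ℚ → StrictlyIncreasing {m} σ × Face σ × length σ ≡ ℓ

∂ : {m : ℕ} → (Simplex m → ℚ) → Simplex m → ℚ
∂ {m} c σ = ΣFin m term
  where
  open DecMem (_≟F_ {m}) using (_∈?_)
  term : Fin m → ℚ
  term v with v ∈? σ
  ... | yes _ = 0ℚ
  ... | no  _ = sgn (proj₁ (insertAt v σ)) * c (proj₂ (insertAt v σ))

-- ℓ-chain c is a cycle (for ℓ = 0 this is vacuous: ∂_{-1} = 0)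
IsCycle : {m : ℕ} → ℕ → (Simplex m → ℚ) → Set
IsCycle {m} ℓ c = ∀ σ → StrictlyIncreasing {m} σ → suc (length σ) ≡ ℓ → ∂ c σ ≡ 0ℚ

IsBoundary : {m : ℕ} → (Face : Simplex m → Set) → ℕ → (Simplex m → ℚ) → Set
IsBoundary {m} Face ℓ c =
  Σ (Simplex m → ℚ) λ d → Chain Face (suc ℓ) d ×
    (∀ σ → StrictlyIncreasing {m} σ → length σ ≡ ℓ → ∂ d σ ≡ c σ)

ReducedHomologyVanishes : {m : ℕ} → (Face : Simplex m → Set) → ℕ → Set
ReducedHomologyVanishes Face ℓ =
  ∀ c → Chain Face ℓ c → IsCycle ℓ c → IsBoundary Face ℓ c

-- Bipartite graphs with sides Fin a and Fin b, edges given by an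
-- adjacency relation.  Edge (i , j) is encoded as the vertex
-- combine i j : Fin (a *ℕ b) of the matching complex.

BipGraph : ℕ → ℕ → Set
BipGraph a b = Fin a → Fin b → Bool

left : {a b : ℕ} → Fin (a *ℕ b) → Fin a
left {a} {b} e = proj₁ (remQuot {a} b e)

right : {a b : ℕ} → Fin (a *ℕ b) → Fin b
right {a} {b} e = proj₂ (remQuot {a} b e)

IsEdge : {a b : ℕ} → BipGraph a b → Fin (a *ℕ b) → Set
IsEdge {a} {b} G e = G (left {a} {b} e) (right {a} {b} e) ≡ true

Disjoint : {a b : ℕ} → Fin (a *ℕ b) → Fin (a *ℕ b) → Set
Disjoint {a} {b} e e' = left {a} {b} e ≢ left {a} {b} e' × right {a} {b} e ≢ right {a} {b} e'

IsMatching : {a b : ℕ} → BipGraph a b → Simplex (a *ℕ b) → Set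
IsMatching {a} {b} G σ = All (IsEdge G) σ × AllPairs (Disjoint {a} {b}) σ

-- η(M(G)) < n  ⇔  H̃_j(M(G); ℚ) ≠ 0 for some -1 ≤ j ≤ n - 2
--              ⇔  ¬ vanishing at some length ℓ = j + 1 < n
EtaMatchingLess : {a b : ℕ} → BipGraph a b → ℕ → Set
EtaMatchingLess G n =
  Σ ℕ λ ℓ → ℓ < n × ¬ ReducedHomologyVanishes (IsMatching G) ℓ

FractionallyBalanced : {a b : ℕ} → BipGraph a b → Set
FractionallyBalanced {a} {b} G =
  Σ (Fin a → Fin b → ℚ) λ f →
    (∀ i j → 0ℚ ≤ℚ f i j) ×
    (∀ i j → G i j ≡ false → f i j ≡ 0ℚ) ×
    (Σ (Fin a) λ i → Σ (Fin b) λ j → f i j ≢ 0ℚ) ×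
    (Σ ℚ λ dA → ∀ i → ΣFin b (f i) ≡ dA) ×
    (Σ ℚ λ dB → ∀ j → ΣFin a (λ i → f i j) ≡ dB)

{-# OPTIONS --safe #-}
module Submission where

-- Write n = N + 1.  Join each of N left vertices to its own block of N right
-- vertices, and a hub to the first vertex of every block.  Weight 1 on edges
-- to first block vertices, N + 1 on the other block edges and N on hub edges
-- gives every left vertex degree N² and every right vertex degree N + 1.
-- For k < N pair the edge from k to the first vertex of block k with the edge
-- to the second one (with the hub edge when N = 1).  These N pairwise
-- disjoint pairs span the boundary of an N-dimensional cross-polytope in
-- M(G), an (N - 1)-cycle.  It has coefficient 1 on the matching of all
-- first-vertex block edges, which is maximal because the hub only reaches
-- first vertices; boundaries vanish on maximal faces, so the cycle is not a
-- boundary.  Hence H̃_{N-1}(M(G); ℚ) ≠ 0 and η(M(G)) ≤ N < n.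

open import Defs
open import Data.Nat
  using (ℕ; zero; suc; _+_; _*_; _≤_; _<_; _∸_; _^_; z≤n; s≤s; _/_; _%_; NonZero)
open import Data.Nat.Properties
open import Data.Nat.DivMod
  using ([m+kn]%n≡m%n; m<n⇒m%n≡m; m<n⇒m/n≡0; m*n/n≡m; +-distrib-/-∣ʳ; m≡m%n+[m/n]*n; m<n*o⇒m/o<n)
open import Data.Nat.Divisibility using (divides-refl)
open import Data.Fin using (Fin; zero; suc; toℕ; fromℕ<; combine; remQuot)
import Data.Fin as Fin
import Data.Fin.Properties as Finₚ
open import Data.Fin.Permutation using (permutation)
open import Data.Bool using (Bool; true; false; if_then_else_)
open import Data.List using ([]; _∷_; length; allFin)
open import Data.List.Properties using (map-tabulate; map-cong)
open import Data.List.Relation.Unary.All as All using (All)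
open import Data.List.Relation.Unary.AllPairs using (AllPairs; []; _∷_)
open import Data.List.Relation.Unary.Any using (here; there)
open import Data.List.Relation.Unary.Linked using ([]; [-]; _∷_)
open import Data.List.Membership.Propositional using (_∈_; _∉_)
import Data.List.Membership.DecPropositional as DecMembership
open import Data.Integer as ℤ using (ℤ)
open import Data.Rational using (ℚ; 0ℚ; 1ℚ; -_; ↥_)
  renaming (_+_ to _+ℚ_; _*_ to _*ℚ_; _≤_ to _≤ℚ_)
import Data.Rational.Properties as ℚₚ
open import Data.Product using (Σ; _×_; _,_; proj₁; proj₂)
open import Data.Sum using (_⊎_; inj₁; inj₂; [_,_]′)
open import Data.Empty using (⊥; ⊥-elim)
open import Function using (_∘_; id)
open import Relation.Binary.Definitions using (tri<; tri≈; tri>)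
open import Relation.Binary.PropositionalEquality
open import Relation.Nullary using (¬_; Dec; yes; no; does)
open import Relation.Nullary.Decidable using (dec-true; dec-false; decidable-stable)
open import Algebra.Properties.CommutativeMonoid.Sum ℚₚ.+-0-commutativeMonoid using (sum; sum-permute)
open import Algebra.Properties.Group ℚₚ.+-0-group using () renaming (⁻¹-involutive to neg-involutive)
open import Algebra.Properties.Monoid.Mult ℚₚ.+-0-monoid using (×-homo-+) renaming (_×_ to _·_)

ΣFin-suc : ∀ {n} (g : Fin (suc n) → ℚ) → ΣFin (suc n) g ≡ g zero +ℚ ΣFin n (g ∘ suc)
ΣFin-suc {n} g =
  cong (λ xs → g zero +ℚ sumℚ xs) (trans (map-tabulate suc g) (sym (map-tabulate id (g ∘ suc))))

ΣFin-cong : ∀ {n} {g h : Fin n → ℚ} → (∀ v → g v ≡ h v) → ΣFin n g ≡ ΣFin n h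
ΣFin-cong {n} g≗h = cong sumℚ (map-cong g≗h (allFin n))

ΣFin≡sum : ∀ n (g : Fin n → ℚ) → ΣFin n g ≡ sum g
ΣFin≡sum zero    g = refl
ΣFin≡sum (suc n) g = trans (ΣFin-suc g) (cong (g zero +ℚ_) (ΣFin≡sum n (g ∘ suc)))

ΣFin-zero : ∀ n {g : Fin n → ℚ} → (∀ v → g v ≡ 0ℚ) → ΣFin n g ≡ 0ℚ
ΣFin-zero zero    g≗0 = refl
ΣFin-zero (suc n) {g} g≗0 = trans (ΣFin-suc g) (cong₂ _+ℚ_ (g≗0 zero) (ΣFin-zero n (g≗0 ∘ suc)))

ΣFin-neg : ∀ n (g : Fin n → ℚ) → ΣFin n (λ v → - g v) ≡ - ΣFin n g
ΣFin-neg zero    g = refl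
ΣFin-neg (suc n) g = begin
  ΣFin (suc n) (λ v → - g v)            ≡⟨ ΣFin-suc (λ v → - g v) ⟩
  - g zero +ℚ ΣFin n (λ v → - g (suc v)) ≡⟨ cong (- g zero +ℚ_) (ΣFin-neg n (g ∘ suc)) ⟩
  - g zero +ℚ - ΣFin n (g ∘ suc)         ≡⟨ ℚₚ.neg-distrib-+ (g zero) _ ⟨
  - (g zero +ℚ ΣFin n (g ∘ suc))         ≡⟨ cong -_ (ΣFin-suc g) ⟨
  - ΣFin (suc n) g                       ∎
  where open ≡-Reasoning

x≡-x⇒x≡0 : ∀ x → x ≡ - x → x ≡ 0ℚ
x≡-x⇒x≡0 x x≡-x = ℚₚ.↥p≡0⇒p≡0 x (numerator (trans (cong ↥_ x≡-x) (ℚₚ.↥-neg x)))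
  where
  numerator : ∀ {i : ℤ} → i ≡ ℤ.- i → i ≡ ℤ.+ 0
  numerator {ℤ.+ zero}   _ = refl
  numerator {ℤ.+ suc _}  ()
  numerator {ℤ.-[1+ _ ]} ()

sign-reversing⇒ΣFin≡0 : ∀ {n} {g : Fin n → ℚ} (sw : Fin n → Fin n) →
  (∀ v → sw (sw v) ≡ v) → (∀ v → g (sw v) ≡ - g v) → ΣFin n g ≡ 0ℚ
sign-reversing⇒ΣFin≡0 {n} {g} sw involutive reverses = x≡-x⇒x≡0 _ (begin
  ΣFin n g               ≡⟨ ΣFin≡sum n g ⟩
  sum g                  ≡⟨ sum-permute g (permutation sw sw involutive involutive) ⟩
  sum (g ∘ sw)           ≡⟨ ΣFin≡sum n (g ∘ sw) ⟨
  ΣFin n (g ∘ sw)        ≡⟨ ΣFin-cong reverses ⟩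
  ΣFin n (λ v → - g v)   ≡⟨ ΣFin-neg n g ⟩
  - ΣFin n g             ∎)
  where open ≡-Reasoning

sumTo : ℕ → (ℕ → ℕ) → ℕ
sumTo zero    h = 0
sumTo (suc n) h = h 0 + sumTo n (h ∘ suc)

sumTo-cong : ∀ n {h h′ : ℕ → ℕ} → (∀ k → k < n → h k ≡ h′ k) → sumTo n h ≡ sumTo n h′
sumTo-cong zero    eq = refl
sumTo-cong (suc n) eq = cong₂ _+_ (eq 0 (s≤s z≤n)) (sumTo-cong n (λ k k<n → eq (suc k) (s≤s k<n)))

sumTo-const : ∀ n c → sumTo n (λ _ → c) ≡ n * c
sumTo-const zero    c = refl
sumTo-const (suc n) c = cong (c +_) (sumTo-const n c)

sumTo-zero : ∀ n {h : ℕ → ℕ} → (∀ k → k < n → h k ≡ 0) → sumTo n h ≡ 0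
sumTo-zero n h≗0 = trans (sumTo-cong n h≗0) (trans (sumTo-const n 0) (*-zeroʳ n))

sumTo-point : ∀ n {i} (h : ℕ → ℕ) → i < n → (∀ k → k < n → k ≢ i → h k ≡ 0) → sumTo n h ≡ h i
sumTo-point (suc n) {zero} h _ off =
  trans (cong (h 0 +_) (sumTo-zero n (λ k k<n → off (suc k) (s≤s k<n) (λ ())))) (+-identityʳ (h 0))
sumTo-point (suc n) {suc i} h (s≤s i<n) off =
  cong₂ _+_ (off 0 (s≤s z≤n) (λ ()))
            (sumTo-point n (h ∘ suc) i<n (λ k k<n k≢i → off (suc k) (s≤s k<n) (k≢i ∘ suc-injective)))

sumTo-suc : ∀ n (h : ℕ → ℕ) → sumTo (suc n) h ≡ sumTo n h + h n
sumTo-suc zero    h = +-identityʳ (h 0)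
sumTo-suc (suc n) h =
  trans (cong (h 0 +_) (sumTo-suc n (h ∘ suc))) (sym (+-assoc (h 0) (sumTo n (h ∘ suc)) (h (suc n))))

sumTo-+ : ∀ m n (h : ℕ → ℕ) → sumTo (m + n) h ≡ sumTo m h + sumTo n (λ k → h (m + k))
sumTo-+ zero    n h = refl
sumTo-+ (suc m) n h = trans (cong (h 0 +_) (sumTo-+ m n (h ∘ suc))) (sym (+-assoc (h 0) _ _))

sumTo-blocks : ∀ m n (h : ℕ → ℕ) → sumTo (m * n) h ≡ sumTo m (λ q → sumTo n (λ r → h (q * n + r)))
sumTo-blocks zero    n h = refl
sumTo-blocks (suc m) n h = begin
  sumTo (n + m * n) h
    ≡⟨ sumTo-+ n (m * n) h ⟩
  sumTo n h + sumTo (m * n) (λ k → h (n + k))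
    ≡⟨ cong (sumTo n h +_) (sumTo-blocks m n (λ k → h (n + k))) ⟩
  sumTo n h + sumTo m (λ q → sumTo n (λ r → h (n + (q * n + r))))
    ≡⟨ cong (sumTo n h +_) (sumTo-cong m (λ q _ → sumTo-cong n (λ r _ → cong h (+-assoc n (q * n) r)))) ⟨
  sumTo n h + sumTo m (λ q → sumTo n (λ r → h (suc q * n + r))) ∎
  where open ≡-Reasoning

ΣFin-·1ℚ : ∀ n (h : ℕ → ℕ) → ΣFin n (λ j → h (toℕ j) · 1ℚ) ≡ sumTo n h · 1ℚ
ΣFin-·1ℚ zero    h = refl
ΣFin-·1ℚ (suc n) h =
  trans (ΣFin-suc {n} (λ j → h (toℕ j) · 1ℚ)) (trans (cong (h 0 · 1ℚ +ℚ_) (ΣFin-·1ℚ n (h ∘ suc)))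
                            (sym (×-homo-+ 1ℚ (h 0) (sumTo n (h ∘ suc)))))

·1ℚ-nonneg : ∀ k → 0ℚ ≤ℚ k · 1ℚ
·1ℚ-nonneg zero    = ℚₚ.≤-refl
·1ℚ-nonneg (suc k) = ℚₚ.+-mono-≤ (ℚₚ.nonNegative⁻¹ 1ℚ) (·1ℚ-nonneg k)

divMod-unique : ∀ {d} q r .{{_ : NonZero d}} → r < d → (q * d + r) / d ≡ q × (q * d + r) % d ≡ r
divMod-unique {d} q r r<d rewrite +-comm (q * d) r =
    trans (+-distrib-/-∣ʳ r (divides-refl q)) (cong₂ _+_ (m<n⇒m/n≡0 r<d) (m*n/n≡m q d))
  , trans ([m+kn]%n≡m%n r q d) (m<n⇒m%n≡m r<d)

module _ {m : ℕ} where

  open DecMembership (Finₚ._≟_ {m}) using (_∈?_)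

  -- The summand of ∂ is local to the where-block of its definition;
  -- unification against ∂ gives it a name.
  record BoundarySummands (c : Simplex m → ℚ) (σ : Simplex m) : Set where
    field
      summand : Fin m → ℚ
      ∂≡Σ     : ∂ c σ ≡ ΣFin m summand

  boundarySummands : ∀ c σ → BoundarySummands c σ
  boundarySummands c σ = record { summand = _ ; ∂≡Σ = refl }

  summand : (Simplex m → ℚ) → Simplex m → Fin m → ℚ
  summand c σ = BoundarySummands.summand (boundarySummands c σ)

  ∂≡Σsummand : ∀ c σ → ∂ c σ ≡ ΣFin m (summand c σ)
  ∂≡Σsummand c σ = BoundarySummands.∂≡Σ (boundarySummands c σ)

  summand-∈ : ∀ {c σ v} → v ∈ σ → summand c σ v ≡ 0ℚ
  summand-∈ {σ = σ} {v} v∈σ with v ∈? σ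
  ... | yes _   = refl
  ... | no v∉σ = ⊥-elim (v∉σ v∈σ)

  summand-∉ : ∀ {c σ v} → v ∉ σ →
    summand c σ v ≡ sgn (proj₁ (insertAt v σ)) *ℚ c (proj₂ (insertAt v σ))
  summand-∉ {σ = σ} {v} v∉σ with v ∈? σ
  ... | yes v∈σ = ⊥-elim (v∉σ v∈σ)
  ... | no _    = refl

  summand-∉-vanishing : ∀ {c σ v} → v ∉ σ → c (proj₂ (insertAt v σ)) ≡ 0ℚ → summand c σ v ≡ 0ℚ
  summand-∉-vanishing {c} {σ} {v} v∉σ c≡0 =
    trans (summand-∉ v∉σ) (trans (cong (s *ℚ_) c≡0) (ℚₚ.*-zeroʳ s))
    where s = sgn (proj₁ (insertAt v σ))

  insertAt-∈ : ∀ (v : Fin m) σ → v ∈ proj₂ (insertAt v σ)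
  insertAt-∈ v []      = here refl
  insertAt-∈ v (z ∷ σ) with v Fin.<? z
  ... | yes _ = here refl
  ... | no _  = there (insertAt-∈ v σ)

  insertAt-⊇ : ∀ (v : Fin m) {w} σ → w ∈ σ → w ∈ proj₂ (insertAt v σ)
  insertAt-⊇ v (z ∷ σ) w∈ with v Fin.<? z
  insertAt-⊇ v (z ∷ σ) w∈         | yes _ = there w∈
  insertAt-⊇ v (z ∷ σ) (here w≡z)  | no _  = here w≡z
  insertAt-⊇ v (z ∷ σ) (there w∈) | no _  = there (insertAt-⊇ v σ w∈)

  data Swapped (x y : Fin m) : Simplex m → Simplex m → Set where
    here  : ∀ {zs} → Swapped x y (x ∷ zs) (y ∷ zs)
    there : ∀ {z xs ys} → Swapped x y xs ys → Swapped x y (z ∷ xs) (z ∷ ys)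

  -- Nothing lies strictly between x and y = x + 1.
  insertAt-successor : ∀ {x y} σ → toℕ y ≡ suc (toℕ x) → x ∉ σ → y ∉ σ →
    proj₁ (insertAt x σ) ≡ proj₁ (insertAt y σ) ×
    Swapped x y (proj₂ (insertAt x σ)) (proj₂ (insertAt y σ))
  insertAt-successor [] _ _ _ = refl , here
  insertAt-successor {x} {y} (z ∷ σ) y≡1+x x∉ y∉ with x Fin.<? z | y Fin.<? z
  ... | yes _   | yes _   = refl , here
  ... | no _    | no _    =
    let eq , swapped = insertAt-successor σ y≡1+x (x∉ ∘ there) (y∉ ∘ there)
    in cong suc eq , there swapped
  ... | yes x<z | no y≮z  =
    ⊥-elim (y∉ (here (Finₚ.toℕ-injective
      (≤-antisym (subst (_≤ toℕ z) (sym y≡1+x) x<z) (≮⇒≥ y≮z)))))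
  ... | no x≮z  | yes y<z =
    ⊥-elim (x≮z (<-trans (subst (toℕ x <_) (sym y≡1+x) (n<1+n (toℕ x))) y<z))

  Inextensible : (Simplex m → Set) → Simplex m → Set
  Inextensible Face σ = ∀ v → v ∉ σ → ¬ Face (proj₂ (insertAt v σ))

  ∂-inextensible : ∀ {Face ℓ d σ} → Chain Face (suc ℓ) d → Inextensible Face σ → ∂ d σ ≡ 0ℚ
  ∂-inextensible {d = d} {σ} chain inextensible =
    trans (∂≡Σsummand d σ) (ΣFin-zero m (λ v → vanishes v (v ∈? σ)))
    where
    vanishes : ∀ v → Dec (v ∈ σ) → summand d σ v ≡ 0ℚ
    vanishes v (yes v∈σ) = summand-∈ v∈σ
    vanishes v (no v∉σ)  = summand-∉-vanishing v∉σ
      (decidable-stable (_ ℚₚ.≟ 0ℚ) (λ d≢0 → inextensible v v∉σ (proj₁ (proj₂ (chain _ d≢0)))))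

  cycle-on-inextensible-face⇒¬vanishes : ∀ {Face ℓ c σ} →
    Chain Face ℓ c → IsCycle ℓ c → StrictlyIncreasing σ → length σ ≡ ℓ →
    Inextensible Face σ → c σ ≢ 0ℚ → ¬ ReducedHomologyVanishes Face ℓ
  cycle-on-inextensible-face⇒¬vanishes {c = c} {σ} chain cycle increasing len inextensible cσ≢0 vanishes
    with vanishes c chain cycle
  ... | d , chain-d , ∂d≡c =
    cσ≢0 (trans (sym (∂d≡c σ increasing len)) (∂-inextensible chain-d inextensible))

allPairs-∈ : ∀ {A : Set} {R : A → A → Set} {xs x y} → AllPairs R xs → x ∈ xs → y ∈ xs → x ≢ y →
  R x y ⊎ R y x
allPairs-∈ (_ ∷ _)   (here refl) (here refl) x≢y = ⊥-elim (x≢y refl)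
allPairs-∈ (Rx ∷ _)  (here refl) (there y∈) _   = inj₁ (All.lookup Rx y∈)
allPairs-∈ (Ry ∷ _)  (there x∈) (here refl) _   = inj₂ (All.lookup Ry x∈)
allPairs-∈ (_ ∷ Rxs) (there x∈) (there y∈) x≢y = allPairs-∈ Rxs x∈ y∈ x≢y

-- The N pairs {u k, u k + 1}, ordered along Fin m, span the boundary of a
-- cross-polytope; cross 0 is its fundamental cycle.

module CrossPolytope {m : ℕ} (N : ℕ) (u : ℕ → ℕ)
  (gap : ∀ k → suc (u k) < u (suc k)) (bounded : ∀ k → k < N → suc (u k) < m) where

  open DecMembership (Finₚ._≟_ {m}) using (_∈?_)

  InPair : ℕ → ℕ → Set
  InPair k x = x ≡ u k ⊎ x ≡ suc (u k)

  u-separated : ∀ {p q} → p < q → suc (u p) < u q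
  u-separated {p} {suc q} (s≤s p≤q) with m≤n⇒m<n∨m≡n p≤q
  ... | inj₁ p<q  = <-trans (u-separated p<q) (<-trans (n<1+n (u q)) (gap q))
  ... | inj₂ refl = gap p

  inPair-bounds : ∀ {k x} → InPair k x → u k ≤ x × x ≤ suc (u k)
  inPair-bounds (inj₁ refl) = ≤-refl , n≤1+n _
  inPair-bounds (inj₂ refl) = n≤1+n _ , ≤-refl

  inPair-unique : ∀ {p q x} → InPair p x → InPair q x → p ≡ q
  inPair-unique {p} {q} px qx with <-cmp p q
  ... | tri< p<q _ _ = ⊥-elim (<⇒≱ (u-separated p<q) (≤-trans (proj₁ (inPair-bounds qx)) (proj₂ (inPair-bounds px))))
  ... | tri≈ _ p≡q _ = p≡q
  ... | tri> _ _ q<p = ⊥-elim (<⇒≱ (u-separated q<p) (≤-trans (proj₁ (inPair-bounds px)) (proj₂ (inPair-bounds qx))))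

  side : ℕ → ℕ → ℚ
  side k x with x ≟ u k | x ≟ suc (u k)
  ... | yes _ | _     = 1ℚ
  ... | no _  | yes _ = - 1ℚ
  ... | no _  | no _  = 0ℚ

  side-lower : ∀ k → side k (u k) ≡ 1ℚ
  side-lower k with u k ≟ u k
  ... | yes _   = refl
  ... | no u≢u = ⊥-elim (u≢u refl)

  side-upper : ∀ k → side k (suc (u k)) ≡ - 1ℚ
  side-upper k with suc (u k) ≟ u k | suc (u k) ≟ suc (u k)
  ... | yes 1+u≡u | _       = ⊥-elim (1+n≢n 1+u≡u)
  ... | no _      | yes _   = refl
  ... | no _      | no ≢1+u = ⊥-elim (≢1+u refl)

  side-outside : ∀ {k x} → ¬ InPair k x → side k x ≡ 0ℚ
  side-outside {k} {x} ∉pair with x ≟ u k | x ≟ suc (u k)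
  ... | yes x≡u | _       = ⊥-elim (∉pair (inj₁ x≡u))
  ... | no _    | yes x≡1+u = ⊥-elim (∉pair (inj₂ x≡1+u))
  ... | no _    | no _    = refl

  side≢0⇒inPair : ∀ {k x} → side k x ≢ 0ℚ → InPair k x
  side≢0⇒inPair {k} {x} side≢0 with x ≟ u k | x ≟ suc (u k)
  ... | yes x≡u | _         = inj₁ x≡u
  ... | no _    | yes x≡1+u = inj₂ x≡1+u
  ... | no _    | no _      = ⊥-elim (side≢0 refl)

  side-flip : ∀ k p → side k (suc (u p)) ≡ - side k (u p)
  side-flip k p with k ≟ p
  ... | yes refl = trans (side-upper k) (cong -_ (sym (side-lower k)))
  ... | no k≢p   = trans (side-outside (λ pair → k≢p (inPair-unique pair (inj₂ refl))))
                         (cong -_ (sym (side-outside (λ pair → k≢p (inPair-unique pair (inj₁ refl))))))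

  -- cross k σ is ±1 if σ lists one vertex of each pair k, …, N - 1 in order
  -- (the sign counts upper vertices) and 0 otherwise.
  cross : ℕ → Simplex m → ℚ
  cross k []       = if does (k ≟ N) then 1ℚ else 0ℚ
  cross k (x ∷ xs) = side k (toℕ x) *ℚ cross (suc k) xs

  data Transversal : ℕ → Simplex m → Set where
    []  : Transversal N []
    _∷_ : ∀ {k x xs} → InPair k (toℕ x) → Transversal (suc k) xs → Transversal k (x ∷ xs)

  cross-support : ∀ {k σ} → cross k σ ≢ 0ℚ → Transversal k σ
  cross-support {k} {[]} cross≢0 with k ≟ N
  ... | yes refl = []
  ... | no k≢N   = ⊥-elim (cross≢0 (cong (if_then 1ℚ else 0ℚ) (dec-false (k ≟ N) k≢N)))
  cross-support {k} {x ∷ xs} cross≢0 =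
      side≢0⇒inPair (λ side≡0 → cross≢0 (trans (cong (_*ℚ rest) side≡0) (ℚₚ.*-zeroˡ rest)))
    ∷ cross-support (λ rest≡0 → cross≢0 (trans (cong (side k (toℕ x) *ℚ_) rest≡0) (ℚₚ.*-zeroʳ (side k (toℕ x)))))
    where rest = cross (suc k) xs

  cross-vanishes : ∀ {k σ} → ¬ Transversal k σ → cross k σ ≡ 0ℚ
  cross-vanishes ¬transversal = decidable-stable (_ ℚₚ.≟ 0ℚ) (¬transversal ∘ cross-support)

  transversal-length : ∀ {k σ} → Transversal k σ → k + length σ ≡ N
  transversal-length {k} []                = +-identityʳ k
  transversal-length {k} {_ ∷ xs} (_ ∷ t) = trans (+-suc k (length xs)) (transversal-length t)

  transversal-∈ : ∀ {k σ x} → Transversal k σ → x ∈ σ → Σ ℕ λ p → k ≤ p × p < N × InPair p (toℕ x)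
  transversal-∈ {k} t@(px ∷ _) (here refl) =
    k , ≤-refl , subst (k <_) (transversal-length t) (m<m+n k (s≤s z≤n)) , px
  transversal-∈ {k} (_ ∷ t) (there x∈) =
    let p , k<p , p<N , px = transversal-∈ t x∈ in p , ≤-trans (n≤1+n k) k<p , p<N , px

  transversal-All : ∀ {P : Fin m → Set} → (∀ {p x} → p < N → InPair p (toℕ x) → P x) →
    ∀ {k σ} → Transversal k σ → All P σ
  transversal-All P-pair t = All.tabulate λ x∈ →
    let _ , _ , p<N , px = transversal-∈ t x∈ in P-pair p<N px

  transversal-AllPairs : ∀ {R : Fin m → Fin m → Set} →
    (∀ {p q x y} → p < q → q < N → InPair p (toℕ x) → InPair q (toℕ y) → R x y) →
    ∀ {k σ} → Transversal k σ → AllPairs R σ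
  transversal-AllPairs R-pairs []       = []
  transversal-AllPairs R-pairs (px ∷ t) =
    All.tabulate (λ y∈ → let _ , k<q , q<N , qy = transversal-∈ t y∈ in R-pairs k<q q<N px qy)
    ∷ transversal-AllPairs R-pairs t

  transversal-increasing : ∀ {k σ} → Transversal k σ → StrictlyIncreasing σ
  transversal-increasing []                = []
  transversal-increasing (_ ∷ [])          = [-]
  transversal-increasing (px ∷ (py ∷ t)) =
    <-≤-trans (≤-<-trans (proj₂ (inPair-bounds px)) (gap _)) (proj₁ (inPair-bounds py))
    ∷ transversal-increasing (py ∷ t)

  transversal-unique : ∀ {k σ p x y} → Transversal k σ → x ∈ σ → y ∈ σ →
    InPair p (toℕ x) → InPair p (toℕ y) → x ≡ y
  transversal-unique (_ ∷ _)   (here refl) (here refl) _ _ = refl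
  transversal-unique (pz ∷ t) (here refl) (there y∈) px py =
    let _ , k<q , _ , qy = transversal-∈ t y∈
    in ⊥-elim (<-irrefl (trans (inPair-unique pz px) (inPair-unique py qy)) k<q)
  transversal-unique (pz ∷ t) (there x∈) (here refl) px py =
    let _ , k<q , _ , qx = transversal-∈ t x∈
    in ⊥-elim (<-irrefl (trans (inPair-unique pz py) (inPair-unique px qx)) k<q)
  transversal-unique (_ ∷ t) (there x∈) (there y∈) px py = transversal-unique t x∈ y∈ px py

  cross-swapped : ∀ {k p x y xs ys} → toℕ x ≡ u p → toℕ y ≡ suc (u p) →
    Swapped x y xs ys → cross k ys ≡ - cross k xs
  cross-swapped {k} {p} {x} {y} {_ ∷ zs} x≡ y≡ here =
    trans (cong (_*ℚ rest) side-y≡-side-x) (sym (ℚₚ.neg-distribˡ-* (side k (toℕ x)) rest))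
    where
    rest = cross (suc k) zs
    side-y≡-side-x : side k (toℕ y) ≡ - side k (toℕ x)
    side-y≡-side-x = trans (cong (side k) y≡) (trans (side-flip k p) (cong (-_ ∘ side k) (sym x≡)))
  cross-swapped {k} {xs = z ∷ _} x≡ y≡ (there swapped) =
    trans (cong (side k (toℕ z) *ℚ_) (cross-swapped x≡ y≡ swapped))
          (sym (ℚₚ.neg-distribʳ-* (side k (toℕ z)) _))

  flip : ℕ → ℕ → ℕ
  flip zero    x = x
  flip (suc j) x with x ≟ u j | x ≟ suc (u j)
  ... | yes _ | _     = suc x
  ... | no _  | yes _ = u j
  ... | no _  | no _  = flip j x

  data Flipped (j x : ℕ) : ℕ → Set where
    fixed : (∀ k → k < j → ¬ InPair k x) → Flipped j x x
    lower : ∀ {k} → k < j → x ≡ u k → Flipped j x (suc (u k))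
    upper : ∀ {k} → k < j → x ≡ suc (u k) → Flipped j x (u k)

  flipped : ∀ j x → Flipped j x (flip j x)
  flipped zero    x = fixed (λ _ ())
  flipped (suc j) x with x ≟ u j | x ≟ suc (u j)
  ... | yes refl | _        = lower (n<1+n j) refl
  ... | no _     | yes refl = upper (n<1+n j) refl
  ... | no x≢u   | no x≢1+u with flip j x | flipped j x
  ...   | _ | fixed ∉pairs = fixed ∉pairs′
    where
    ∉pairs′ : ∀ k → k < suc j → ¬ InPair k x
    ∉pairs′ k (s≤s k≤j) with m≤n⇒m<n∨m≡n k≤j
    ... | inj₁ k<j  = ∉pairs k k<j
    ... | inj₂ refl = λ { (inj₁ x≡u) → x≢u x≡u ; (inj₂ x≡1+u) → x≢1+u x≡1+u }
  ...   | _ | lower k<j x≡u   = lower (m<n⇒m<1+n k<j) x≡u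
  ...   | _ | upper k<j x≡1+u = upper (m<n⇒m<1+n k<j) x≡1+u

  u≢1+u : ∀ k k′ → u k ≢ suc (u k′)
  u≢1+u k k′ u≡1+u′ = 1+n≢n (trans (sym u≡1+u′) (cong u (inPair-unique (inj₁ refl) (inj₂ u≡1+u′))))

  flipped-unique : ∀ {j x y y′} → Flipped j x y → Flipped j x y′ → y ≡ y′
  flipped-unique (fixed _)        (fixed _)         = refl
  flipped-unique (fixed ∉pairs)   (lower k<j x≡u)   = ⊥-elim (∉pairs _ k<j (inj₁ x≡u))
  flipped-unique (fixed ∉pairs)   (upper k<j x≡1+u) = ⊥-elim (∉pairs _ k<j (inj₂ x≡1+u))
  flipped-unique (lower k<j x≡u)   (fixed ∉pairs)   = ⊥-elim (∉pairs _ k<j (inj₁ x≡u))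
  flipped-unique (upper k<j x≡1+u) (fixed ∉pairs)   = ⊥-elim (∉pairs _ k<j (inj₂ x≡1+u))
  flipped-unique (lower _ x≡u)     (lower _ x≡u′)   = cong (suc ∘ u) (inPair-unique (inj₁ x≡u) (inj₁ x≡u′))
  flipped-unique (upper _ x≡1+u)   (upper _ x≡1+u′) = cong u (inPair-unique (inj₂ x≡1+u) (inj₂ x≡1+u′))
  flipped-unique (lower _ x≡u)     (upper _ x≡1+u′) = ⊥-elim (u≢1+u _ _ (trans (sym x≡u) x≡1+u′))
  flipped-unique (upper _ x≡1+u)   (lower _ x≡u′)   = ⊥-elim (u≢1+u _ _ (trans (sym x≡u′) x≡1+u))

  flip-involutive : ∀ x → flip N (flip N x) ≡ x
  flip-involutive x with flip N x | flipped N x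
  ... | _ | fixed ∉pairs   = flipped-unique (flipped N x) (fixed ∉pairs)
  ... | _ | lower k<N refl = flipped-unique (flipped N _) (upper k<N refl)
  ... | _ | upper k<N refl = flipped-unique (flipped N _) (lower k<N refl)

  flip<m : ∀ {x} → x < m → flip N x < m
  flip<m {x} x<m with flip N x | flipped N x
  ... | _ | fixed _     = x<m
  ... | _ | lower k<N _ = bounded _ k<N
  ... | _ | upper k<N _ = <-trans (n<1+n _) (bounded _ k<N)

  swap : Fin m → Fin m
  swap v = fromℕ< (flip<m (Finₚ.toℕ<n v))

  toℕ-swap : ∀ v → toℕ (swap v) ≡ flip N (toℕ v)
  toℕ-swap v = Finₚ.toℕ-fromℕ< _

  swap-involutive : ∀ v → swap (swap v) ≡ v
  swap-involutive v = Finₚ.toℕ-injective (begin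
    toℕ (swap (swap v))   ≡⟨ toℕ-swap (swap v) ⟩
    flip N (toℕ (swap v)) ≡⟨ cong (flip N) (toℕ-swap v) ⟩
    flip N (flip N (toℕ v)) ≡⟨ flip-involutive (toℕ v) ⟩
    toℕ v                 ∎)
    where open ≡-Reasoning

  module _ (σ : Simplex m) where

    private
      term : Fin m → ℚ
      term = summand (cross 0) σ

    summand-unpaired : ∀ {v} → (∀ k → k < N → ¬ InPair k (toℕ v)) → term v ≡ 0ℚ
    summand-unpaired {v} ∉pairs = by-membership (v ∈? σ)
      where
      by-membership : Dec (v ∈ σ) → term v ≡ 0ℚ
      by-membership (yes v∈σ) = summand-∈ v∈σ
      by-membership (no v∉σ)  = summand-∉-vanishing v∉σ (cross-vanishes λ t →
        let _ , _ , p<N , pv = transversal-∈ t (insertAt-∈ v σ) in ∉pairs _ p<N pv)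

    summand-partner-present : ∀ {k v w} → v ∈ σ → w ∉ σ → v ≢ w →
      InPair k (toℕ v) → InPair k (toℕ w) → term w ≡ 0ℚ
    summand-partner-present {w = w} v∈σ w∉σ v≢w pv pw = summand-∉-vanishing w∉σ (cross-vanishes λ t →
      v≢w (transversal-unique t (insertAt-⊇ w σ v∈σ) (insertAt-∈ w σ) pv pw))

    -- If σ contains one vertex of the pair, both summands vanish: inserting
    -- the other one puts two vertices of a pair together.  Otherwise both
    -- vertices are inserted at the same position.
    summand-pair : ∀ {k x y} → toℕ x ≡ u k → toℕ y ≡ suc (u k) → term y ≡ - term x
    summand-pair {x = x} {y} x≡u y≡1+u = by-membership (x ∈? σ) (y ∈? σ)
      where
      x≢y : x ≢ y
      x≢y refl = 1+n≢n (trans (sym y≡1+u) x≡u)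
      px = inj₁ x≡u
      py = inj₂ y≡1+u

      by-membership : Dec (x ∈ σ) → Dec (y ∈ σ) → term y ≡ - term x
      by-membership (yes x∈σ) (yes y∈σ) = trans (summand-∈ y∈σ) (cong -_ (sym (summand-∈ x∈σ)))
      by-membership (yes x∈σ) (no y∉σ)  =
        trans (summand-partner-present x∈σ y∉σ x≢y px py) (cong -_ (sym (summand-∈ x∈σ)))
      by-membership (no x∉σ)  (yes y∈σ) =
        trans (summand-∈ y∈σ) (cong -_ (sym (summand-partner-present y∈σ x∉σ (x≢y ∘ sym) py px)))
      by-membership (no x∉σ)  (no y∉σ)  = begin
        term y                          ≡⟨ summand-∉ y∉σ ⟩
        sgn pos-y *ℚ cross 0 ins-y      ≡⟨ cong₂ (λ p c → sgn p *ℚ c) (sym same-position) (cross-swapped x≡u y≡1+u swapped) ⟩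
        sgn pos-x *ℚ - cross 0 ins-x    ≡⟨ ℚₚ.neg-distribʳ-* (sgn pos-x) (cross 0 ins-x) ⟨
        - (sgn pos-x *ℚ cross 0 ins-x)  ≡⟨ cong -_ (summand-∉ x∉σ) ⟨
        - term x                        ∎
        where
        open ≡-Reasoning
        pos-x = proj₁ (insertAt x σ)
        ins-x = proj₂ (insertAt x σ)
        pos-y = proj₁ (insertAt y σ)
        ins-y = proj₂ (insertAt y σ)
        same-position = proj₁ (insertAt-successor σ (trans y≡1+u (cong suc (sym x≡u))) x∉σ y∉σ)
        swapped       = proj₂ (insertAt-successor σ (trans y≡1+u (cong suc (sym x≡u))) x∉σ y∉σ)

    summand-swap : ∀ v → term (swap v) ≡ - term v
    summand-swap v = by-flip (flipped N (toℕ v)) (toℕ-swap v)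
      where
      by-flip : ∀ {y} → Flipped N (toℕ v) y → toℕ (swap v) ≡ y → term (swap v) ≡ - term v
      by-flip (fixed ∉pairs) swap≡ =
        trans (cong term (Finₚ.toℕ-injective swap≡))
              (trans (summand-unpaired ∉pairs) (cong -_ (sym (summand-unpaired ∉pairs))))
      by-flip (lower _ v≡u) swap≡ = summand-pair v≡u swap≡
      by-flip (upper _ v≡1+u) swap≡ =
        trans (sym (neg-involutive (term (swap v)))) (cong -_ (sym (summand-pair swap≡ v≡1+u)))

  cross-cycle : IsCycle N (cross 0)
  cross-cycle σ _ _ =
    trans (∂≡Σsummand (cross 0) σ) (sign-reversing⇒ΣFin≡0 swap swap-involutive (summand-swap σ))

  cross-chain : ∀ {Face : Simplex m → Set} → (∀ {σ} → Transversal 0 σ → Face σ) → Chain Face N (cross 0)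
  cross-chain face σ cross≢0 = transversal-increasing t , face t , transversal-length t
    where t = cross-support cross≢0

  lowerVertex : ∀ k → k < N → Fin m
  lowerVertex k k<N = fromℕ< (<-trans (n<1+n (u k)) (bounded k k<N))

  toℕ-lowerVertex : ∀ k k<N → toℕ (lowerVertex k k<N) ≡ u k
  toℕ-lowerVertex k k<N = Finₚ.toℕ-fromℕ< (<-trans (n<1+n (u k)) (bounded k k<N))

  1+r+k≡N⇒k<N : ∀ {k} r → suc r + k ≡ N → k < N
  1+r+k≡N⇒k<N {k} r 1+r+k≡N = subst (k <_) 1+r+k≡N (m<n+m k (s≤s z≤n))

  lowers : ∀ k r → r + k ≡ N → Simplex m
  lowers k zero    _   = []
  lowers k (suc r) r+k = lowerVertex k (1+r+k≡N⇒k<N r r+k) ∷ lowers (suc k) r (trans (+-suc r k) r+k)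

  cross-lowers : ∀ k r r+k → cross k (lowers k r r+k) ≡ 1ℚ
  cross-lowers k zero    k≡N = cong (if_then 1ℚ else 0ℚ) (dec-true (k ≟ N) k≡N)
  cross-lowers k (suc r) r+k =
    cong₂ _*ℚ_ (trans (cong (side k) (toℕ-lowerVertex k (1+r+k≡N⇒k<N r r+k))) (side-lower k))
               (cross-lowers (suc k) r (trans (+-suc r k) r+k))

  lowers-covers : ∀ k r r+k {p} → k ≤ p → p < r + k →
    Σ (Fin m) λ x → x ∈ lowers k r r+k × toℕ x ≡ u p
  lowers-covers k zero    _   k≤p p<k = ⊥-elim (<⇒≱ p<k k≤p)
  lowers-covers k (suc r) r+k {p} k≤p p<r+k with m≤n⇒m<n∨m≡n k≤p
  ... | inj₂ refl = _ , here refl , toℕ-lowerVertex k (1+r+k≡N⇒k<N r r+k)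
  ... | inj₁ k<p  =
    let x , x∈ , x≡u = lowers-covers (suc k) r (trans (+-suc r k) r+k) k<p (subst (p <_) (sym (+-suc r k)) p<r+k)
    in x , there x∈ , x≡u

  σ₀ : Simplex m
  σ₀ = lowers 0 N (+-identityʳ N)

  cross-σ₀≢0 : cross 0 σ₀ ≢ 0ℚ
  cross-σ₀≢0 cross≡0 = ℚₚ.1≢0 (trans (sym (cross-lowers 0 N _)) cross≡0)

  σ₀-transversal : Transversal 0 σ₀
  σ₀-transversal = cross-support cross-σ₀≢0

  σ₀-covers : ∀ {p} → p < N → Σ (Fin m) λ x → x ∈ σ₀ × toℕ x ≡ u p
  σ₀-covers p<N = lowers-covers 0 N _ z≤n (subst (_ <_) (sym (+-identityʳ N)) p<N)

module Construction (K : ℕ) where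

  N a b : ℕ
  N = suc K
  a = suc N
  b = N ^ 2

  b≡N*N : b ≡ N * N
  b≡N*N = cong (N *_) (*-identityʳ N)

  -- Right vertex q * N + r is vertex r of block q.  Left vertex i < N is
  -- joined to block i, the hub N to vertex 0 of every block; G is the
  -- support of the weighting.
  blockWeight : ℕ → ℕ
  blockWeight zero    = 1
  blockWeight (suc _) = suc N

  weight : ℕ → ℕ → ℕ → ℕ
  weight i q r = if does (i <? N) then (if does (q ≟ i) then blockWeight r else 0)
                                  else (if does (r ≟ 0) then N else 0)

  edgeWeight : ℕ → ℕ → ℕ
  edgeWeight i j = weight i (j / N) (j % N)

  positive : ℕ → Bool
  positive zero    = false
  positive (suc _) = true

  G : BipGraph a b
  G i j = positive (edgeWeight (toℕ i) (toℕ j))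

  weight-block : ∀ {i} q r → i < N → weight i q r ≡ (if does (q ≟ i) then blockWeight r else 0)
  weight-block {i} q r i<N rewrite dec-true (i <? N) i<N = refl

  weight-own-block : ∀ {q} r → q < N → weight q q r ≡ blockWeight r
  weight-own-block {q} r q<N =
    trans (weight-block q r q<N) (cong (if_then blockWeight r else 0) (dec-true (q ≟ q) refl))

  weight-other-block : ∀ {i q} r → i < N → q ≢ i → weight i q r ≡ 0
  weight-other-block {i} {q} r i<N q≢i =
    trans (weight-block q r i<N) (cong (if_then blockWeight r else 0) (dec-false (q ≟ i) q≢i))

  weight-hub : ∀ {i} q r → ¬ i < N → weight i q r ≡ (if does (r ≟ 0) then N else 0)
  weight-hub {i} q r i≮N rewrite dec-false (i <? N) i≮N = refl

  edgeWeight-block : ∀ i q r → r < N → edgeWeight i (q * N + r) ≡ weight i q r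
  edgeWeight-block i q r r<N =
    cong₂ (weight i) (proj₁ (divMod-unique q r r<N)) (proj₂ (divMod-unique q r r<N))

  sumTo-blockWeight : sumTo N blockWeight ≡ N * N
  sumTo-blockWeight = cong suc (trans (sumTo-const K (suc N)) (*-suc K (suc K)))

  left-degree-block : ∀ {i} → i < N → sumTo N (λ q → sumTo N (weight i q)) ≡ N * N
  left-degree-block {i} i<N = begin
    sumTo N (λ q → sumTo N (weight i q)) ≡⟨ sumTo-point N (λ q → sumTo N (weight i q)) i<N other-block ⟩
    sumTo N (weight i i)                 ≡⟨ sumTo-cong N (λ r _ → weight-own-block r i<N) ⟩
    sumTo N blockWeight                  ≡⟨ sumTo-blockWeight ⟩
    N * N                                ∎
    where
    open ≡-Reasoning
    other-block : ∀ q → q < N → q ≢ i → sumTo N (weight i q) ≡ 0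
    other-block q _ q≢i = sumTo-zero N (λ r _ → weight-other-block r i<N q≢i)

  left-degree-hub : ∀ {i} → ¬ i < N → sumTo N (λ q → sumTo N (weight i q)) ≡ N * N
  left-degree-hub {i} i≮N = trans (sumTo-cong N (λ q _ → vertex-0 q)) (sumTo-const N N)
    where
    vertex-0 : ∀ q → sumTo N (weight i q) ≡ N
    vertex-0 q = trans (sumTo-point N (weight i q) (s≤s z≤n) (λ r _ r≢0 →
                          trans (weight-hub q r i≮N) (cong (if_then N else 0) (dec-false (r ≟ 0) r≢0))))
                       (weight-hub q 0 i≮N)

  left-degree : ∀ i → sumTo b (edgeWeight i) ≡ N * N
  left-degree i = begin
    sumTo b (edgeWeight i)                                    ≡⟨ cong (λ n → sumTo n (edgeWeight i)) b≡N*N ⟩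
    sumTo (N * N) (edgeWeight i)                              ≡⟨ sumTo-blocks N N (edgeWeight i) ⟩
    sumTo N (λ q → sumTo N (λ r → edgeWeight i (q * N + r)))
      ≡⟨ sumTo-cong N (λ q _ → sumTo-cong N (λ r → edgeWeight-block i q r)) ⟩
    sumTo N (λ q → sumTo N (weight i q))                      ≡⟨ by-role (i <? N) ⟩
    N * N                                                     ∎
    where
    open ≡-Reasoning
    by-role : Dec (i < N) → sumTo N (λ q → sumTo N (weight i q)) ≡ N * N
    by-role (yes i<N) = left-degree-block i<N
    by-role (no i≮N)  = left-degree-hub i≮N

  right-degree : ∀ j → j < b → sumTo a (λ i → edgeWeight i j) ≡ suc N
  right-degree j j<b = begin
    sumTo a (λ i → weight i q r)                    ≡⟨ sumTo-suc N (λ i → weight i q r) ⟩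
    sumTo N (λ i → weight i q r) + weight N q r     ≡⟨ cong₂ _+_ block-vertex (weight-hub q r (<-irrefl refl)) ⟩
    blockWeight r + (if does (r ≟ 0) then N else 0) ≡⟨ vertex-0-or-not r ⟩
    suc N                                           ∎
    where
    open ≡-Reasoning
    q r : ℕ
    q = j / N
    r = j % N
    q<N : q < N
    q<N = m<n*o⇒m/o<n (subst (j <_) b≡N*N j<b)
    block-vertex : sumTo N (λ i → weight i q r) ≡ blockWeight r
    block-vertex = trans (sumTo-point N (λ i → weight i q r) q<N
                                      (λ i i<N i≢q → weight-other-block r i<N (i≢q ∘ sym)))
                         (weight-own-block r q<N)
    vertex-0-or-not : ∀ r → blockWeight r + (if does (r ≟ 0) then N else 0) ≡ suc N
    vertex-0-or-not zero    = refl
    vertex-0-or-not (suc _) = +-identityʳ (suc N)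

  balanced : FractionallyBalanced G
  balanced = f , (λ i j → ·1ℚ-nonneg (edgeWeight (toℕ i) (toℕ j))) , outside-support
           , (zero , zero , ℚₚ.1≢0)
           , ((N * N) · 1ℚ , λ i → trans (ΣFin-·1ℚ b (edgeWeight (toℕ i))) (cong (_· 1ℚ) (left-degree (toℕ i))))
           , ((suc N) · 1ℚ , λ j → trans (ΣFin-·1ℚ a (λ i → edgeWeight i (toℕ j)))
                                        (cong (_· 1ℚ) (right-degree (toℕ j) (Finₚ.toℕ<n j))))
    where
    f : Fin a → Fin b → ℚ
    f i j = edgeWeight (toℕ i) (toℕ j) · 1ℚ
    outside-support : ∀ i j → G i j ≡ false → f i j ≡ 0ℚ
    outside-support i j = unweighted (edgeWeight (toℕ i) (toℕ j))
      where
      unweighted : ∀ w → positive w ≡ false → w · 1ℚ ≡ 0ℚ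
      unweighted zero _ = refl

  -- Edge (i, j) has index i * b + j in Fin (a * b).  With S = b + N, u k is the
  -- edge from k to vertex 0 of block k and u k + 1 the next edge: to vertex 1
  -- of block k or, if N = 1, from the hub to vertex 0.
  S : ℕ
  S = b + N

  u : ℕ → ℕ
  u k = k * S

  gap : ∀ k → suc (u k) < u (suc k)
  gap k = +-monoˡ-≤ (k * S) (+-mono-≤ {1} {b} {1} {N} (s≤s z≤n) (s≤s z≤n))

  bounded : ∀ k → k < N → suc (u k) < a * b
  bounded k k<N = begin-strict
    suc (k * S)   <⟨ gap k ⟩
    suc k * S     ≤⟨ *-monoˡ-≤ S k<N ⟩
    N * (b + N)   ≡⟨ *-distribˡ-+ N b N ⟩
    N * b + N * N ≡⟨ cong (N * b +_) b≡N*N ⟨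
    N * b + b     ≡⟨ +-comm (N * b) b ⟩
    a * b         ∎
    where open ≤-Reasoning

  open CrossPolytope {a * b} N u gap bounded

  decode : ∀ (x : Fin (a * b)) {i j} → i < a → j < b → toℕ x ≡ i * b + j →
    toℕ (left {a} {b} x) ≡ i × toℕ (right {a} {b} x) ≡ j
  decode x {i} {j} i<a j<b x≡ =
    trans (cong (toℕ ∘ proj₁) remQuot-x) (Finₚ.toℕ-fromℕ< i<a) ,
    trans (cong (toℕ ∘ proj₂) remQuot-x) (Finₚ.toℕ-fromℕ< j<b)
    where
    x≡combine : x ≡ combine (fromℕ< i<a) (fromℕ< j<b)
    x≡combine = Finₚ.toℕ-injective (begin
      toℕ x                                       ≡⟨ x≡ ⟩
      i * b + j                                   ≡⟨ cong (_+ j) (*-comm i b) ⟩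
      b * i + j                                   ≡⟨ cong₂ (λ i′ j′ → b * i′ + j′) (Finₚ.toℕ-fromℕ< i<a) (Finₚ.toℕ-fromℕ< j<b) ⟨
      b * toℕ (fromℕ< i<a) + toℕ (fromℕ< j<b)     ≡⟨ Finₚ.toℕ-combine (fromℕ< i<a) (fromℕ< j<b) ⟨
      toℕ (combine (fromℕ< i<a) (fromℕ< j<b))     ∎)
      where open ≡-Reasoning
    remQuot-x : remQuot {a} b x ≡ (fromℕ< i<a , fromℕ< j<b)
    remQuot-x = trans (cong (remQuot b) x≡combine) (Finₚ.remQuot-combine (fromℕ< i<a) (fromℕ< j<b))

  InBlock : ℕ → Fin (a * b) → Set
  InBlock k x = Σ ℕ λ t → t < N × toℕ (left {a} {b} x) ≡ k × toℕ (right {a} {b} x) ≡ k * N + t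

  block-endpoints : ∀ {k t x} → k < N → t < N → toℕ x ≡ k * S + t → InBlock k x
  block-endpoints {k} {t} {x} k<N t<N x≡ =
    t , t<N , decode x (m<n⇒m<1+n k<N) block-vertex<b
                (trans x≡ (trans (cong (_+ t) (*-distribˡ-+ k b N)) (+-assoc (k * b) (k * N) t)))
    where
    block-vertex<b : k * N + t < b
    block-vertex<b = begin-strict
      k * N + t  <⟨ +-monoʳ-< (k * N) t<N ⟩
      k * N + N  ≡⟨ +-comm (k * N) N ⟩
      suc k * N  ≤⟨ *-monoˡ-≤ N k<N ⟩
      N * N      ≡⟨ b≡N*N ⟨
      b          ∎
      where open ≤-Reasoning

  lower-in-block : ∀ {k x} → k < N → toℕ x ≡ u k → InBlock k x
  lower-in-block k<N x≡u = block-endpoints k<N (s≤s z≤n) (trans x≡u (sym (+-identityʳ _)))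

  pair-in-block : ∀ {k x} → 1 < N → k < N → InPair k (toℕ x) → InBlock k x
  pair-in-block 1<N k<N (inj₁ x≡u)   = lower-in-block k<N x≡u
  pair-in-block 1<N k<N (inj₂ x≡1+u) = block-endpoints k<N 1<N (trans x≡1+u (+-comm 1 _))

  edge : ∀ x {i q r} → toℕ (left {a} {b} x) ≡ i → toℕ (right {a} {b} x) ≡ q * N + r → r < N →
    positive (weight i q r) ≡ true → IsEdge G x
  edge x {i} {q} {r} left≡ right≡ r<N positive-weight =
    trans (cong positive (trans (cong₂ edgeWeight left≡ right≡) (edgeWeight-block i q r r<N))) positive-weight

  in-block-edge : ∀ {k x} → k < N → InBlock k x → IsEdge G x
  in-block-edge {k} {x} k<N (t , t<N , left≡ , right≡) =
    edge x {k} {k} {t} left≡ right≡ t<N (trans (cong positive (weight-own-block t k<N)) (blockWeight-positive t))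
    where
    blockWeight-positive : ∀ t → positive (blockWeight t) ≡ true
    blockWeight-positive zero    = refl
    blockWeight-positive (suc _) = refl

  pair-edge : ∀ {k x} → k < N → InPair k (toℕ x) → IsEdge G x
  pair-edge {x = x} k<N (inj₁ x≡u) = in-block-edge {x = x} k<N (lower-in-block k<N x≡u)
  pair-edge {k} {x} k<N (inj₂ x≡1+u) with 1 <? N
  ... | yes 1<N = in-block-edge {x = x} k<N (pair-in-block 1<N k<N (inj₂ x≡1+u))
  ... | no 1≮N  = edge x {1} {0} {0} (proj₁ hub-edge) (proj₂ hub-edge) (s≤s z≤n)
                       (cong positive (weight-hub 0 0 1≮N))
    where
    N≡1 : N ≡ 1
    N≡1 = ≤-antisym (≮⇒≥ 1≮N) (s≤s z≤n)
    x≡1 : toℕ x ≡ 1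
    x≡1 = trans x≡1+u (cong (λ k → suc (u k)) (n<1⇒n≡0 (subst (k <_) N≡1 k<N)))
    b≡1 : b ≡ 1
    b≡1 = trans b≡N*N (cong₂ _*_ N≡1 N≡1)
    hub-edge : toℕ (left {a} {b} x) ≡ 1 × toℕ (right {a} {b} x) ≡ 0
    hub-edge = decode x (s≤s (s≤s z≤n)) (s≤s z≤n)
      (trans x≡1 (sym (trans (+-identityʳ (1 * b)) (trans (*-identityˡ b) b≡1))))

  blocks-disjoint : ∀ {p q x y} → p ≢ q → InBlock p x → InBlock q y → Disjoint {a} {b} x y
  blocks-disjoint {p} {q} p≢q (t , t<N , left-x , right-x) (t′ , t′<N , left-y , right-y) =
      (λ left≡ → p≢q (trans (sym left-x) (trans (cong toℕ left≡) left-y)))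
    , (λ right≡ → p≢q (begin
        p                     ≡⟨ proj₁ (divMod-unique p t t<N) ⟨
        (p * N + t) / N       ≡⟨ cong (_/ N) (trans (sym right-x) (trans (cong toℕ right≡) right-y)) ⟩
        (q * N + t′) / N      ≡⟨ proj₁ (divMod-unique q t′ t′<N) ⟩
        q                     ∎))
    where open ≡-Reasoning

  pairs-disjoint : ∀ {p q x y} → p < q → q < N → InPair p (toℕ x) → InPair q (toℕ y) →
    Disjoint {a} {b} x y
  pairs-disjoint {x = x} {y} p<q q<N px qy =
    blocks-disjoint {x = x} {y} (<⇒≢ p<q) (pair-in-block 1<N (<-trans p<q q<N) px) (pair-in-block 1<N q<N qy)
    where
    1<N : 1 < N
    1<N = ≤-trans (s≤s (≤-trans (s≤s z≤n) p<q)) q<N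

  transversal-matching : ∀ {σ} → Transversal 0 σ → IsMatching G σ
  transversal-matching t = transversal-All pair-edge t , transversal-AllPairs pairs-disjoint t

  hub-vertex-0 : ∀ {i q r} → ¬ i < N → positive (weight i q r) ≡ true → r ≡ 0
  hub-vertex-0 {i} {q} {r} i≮N positive-weight = by-offset (r ≟ 0)
    where
    by-offset : Dec (r ≡ 0) → r ≡ 0
    by-offset (yes r≡0) = r≡0
    by-offset (no r≢0)  = ⊥-elim (false≢true (trans (cong positive weight≡0) positive-weight))
      where
      weight≡0 : 0 ≡ weight i q r
      weight≡0 = sym (trans (weight-hub q r i≮N) (cong (if_then N else 0) (dec-false (r ≟ 0) r≢0)))
      false≢true : false ≢ true
      false≢true ()

  σ₀-inextensible : Inextensible (IsMatching G) σ₀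
  σ₀-inextensible v v∉σ₀ (edges , disjoint) = by-role (i <? N)
    where
    i j : ℕ
    i = toℕ (left {a} {b} v)
    j = toℕ (right {a} {b} v)

    shares-endpoint : ∀ {x} → x ∈ σ₀ →
      left {a} {b} x ≡ left {a} {b} v ⊎ right {a} {b} x ≡ right {a} {b} v → ⊥
    shares-endpoint {x} x∈σ₀ shared
      with allPairs-∈ disjoint (insertAt-⊇ v σ₀ x∈σ₀) (insertAt-∈ v σ₀)
                      (λ x≡v → v∉σ₀ (subst (_∈ σ₀) x≡v x∈σ₀))
    ... | inj₁ (left≢ , right≢) = [ left≢ , right≢ ]′ shared
    ... | inj₂ (left≢ , right≢) = [ left≢ ∘ sym , right≢ ∘ sym ]′ shared

    by-role : Dec (i < N) → ⊥
    by-role (yes i<N) =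
      let x , x∈σ₀ , x≡u = σ₀-covers i<N
          _ , _ , left-x , _ = lower-in-block {x = x} i<N x≡u
      in shares-endpoint x∈σ₀ (inj₁ (Finₚ.toℕ-injective left-x))
    by-role (no i≮N) =
      let x , x∈σ₀ , x≡u = σ₀-covers q<N
          _ , _ , _ , right-x = lower-in-block {x = x} q<N x≡u
      in shares-endpoint x∈σ₀ (inj₂ (Finₚ.toℕ-injective (trans right-x (sym j≡qN))))
      where
      q r : ℕ
      q = j / N
      r = j % N
      q<N : q < N
      q<N = m<n*o⇒m/o<n (subst (j <_) b≡N*N (Finₚ.toℕ<n (right {a} {b} v)))
      j≡qN : j ≡ q * N + 0
      j≡qN = trans (m≡m%n+[m/n]*n j N) (trans (+-comm r (q * N)) (cong (q * N +_) r≡0))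
        where r≡0 = hub-vertex-0 {i} {q} {r} i≮N (All.lookup edges (insertAt-∈ v σ₀))

  homology-nonvanishing : ¬ ReducedHomologyVanishes (IsMatching G) N
  homology-nonvanishing = cycle-on-inextensible-face⇒¬vanishes (cross-chain transversal-matching) cross-cycle
    (transversal-increasing σ₀-transversal) (transversal-length σ₀-transversal) σ₀-inextensible cross-σ₀≢0

claim6p10 : (n : ℕ) → 2 ≤ n →
    Σ (BipGraph n ((n ∸ 1) ^ 2)) λ G → FractionallyBalanced G × EtaMatchingLess G n
claim6p10 (suc zero) (s≤s ())
claim6p10 (suc (suc K)) _ = G , balanced , (N , n<1+n N , homology-nonvanishing)
  where open Construction K
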